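{- Let $G$ be a finite, connected multigraph without loop edges with Laplacian matrix $Q$, let $q\in V(G)$, and let $L_{(q)}$ be the matrix defined below. For $D\in\operatorname{Div}(G)$, let $D'$ be the divisor with $[D']=[D]-Q\lfloor L_{(q)}[D]\rfloor$, where $\lfloor\cdot\rfloor$ is the coordinatewise floor. Then $|D'(v)|<\deg(v)$ for all $v\neq q$.
   Context: Label $V(G)=\{v_1,\dots,v_n\}$; $[D]$ is the column vector of coefficients of $D$. The Laplacian matrix $Q$ has $Q_{ii}=\deg(v_i)$ and $Q_{ij}=-$(number of edges joining $v_i,v_j$) for $i\ne j$. If $q=v_i$, let $Q_i$ be the invertible matrix obtained by deleting the $i$-th row and column of $Q$, and let $L_{(q)}$ be the $n\times n$ matrix obtained from $Q_i^{ -1}$ by inserting a zero row and a zero column in position $i$. -}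

module Defs where

open import Data.Nat as ℕ using (ℕ; zero; suc)
open import Data.Integer as ℤ using (ℤ; +_)
open import Data.Rational as ℚ using (ℚ; floor; 0ℚ; 1ℚ)
open import Data.Fin using (Fin; zero; suc; _≟_)
open import Relation.Nullary using (yes; no; ¬_)
open import Relation.Binary.PropositionalEquality using (_≡_)

sumℕ : ∀ {n} → (Fin n → ℕ) → ℕ
sumℕ {zero}  f = 0
sumℕ {suc n} f = f zero ℕ.+ sumℕ (λ i → f (suc i))

sumℤ : ∀ {n} → (Fin n → ℤ) → ℤ
sumℤ {zero}  f = + 0
sumℤ {suc n} f = f zero ℤ.+ sumℤ (λ i → f (suc i))

sumℚ : ∀ {n} → (Fin n → ℚ) → ℚ
sumℚ {zero}  f = 0ℚ
sumℚ {suc n} f = f zero ℚ.+ sumℚ (λ i → f (suc i))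

-- A finite multigraph on vertex set Fin n, given by its edge-multiplicity
-- matrix: mult i j = number of edges joining v_i and v_j.
record Multigraph (n : ℕ) : Set where
  field
    mult      : Fin n → Fin n → ℕ
    symmetric : ∀ i j → mult i j ≡ mult j i

Loopless : ∀ {n} → Multigraph n → Set
Loopless G = ∀ i → Multigraph.mult G i i ≡ 0

data Reachable {n} (G : Multigraph n) : Fin n → Fin n → Set where
  here : ∀ {i} → Reachable G i i
  step : ∀ {i j k} → 0 ℕ.< Multigraph.mult G i j → Reachable G j k → Reachable G i k

Connected : ∀ {n} → Multigraph n → Set
Connected G = ∀ i j → Reachable G i j

-- Degree (for a loopless multigraph: number of incident edges).
deg : ∀ {n} → Multigraph n → Fin n → ℕ
deg G i = sumℕ (λ k → Multigraph.mult G i k)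

laplacian : ∀ {n} → Multigraph n → Fin n → Fin n → ℤ
laplacian G i j with i ≟ j
... | yes _ = + deg G i
... | no  _ = ℤ.- (+ Multigraph.mult G i j)

Div : ℕ → Set
Div n = Fin n → ℤ

toℚ : ℤ → ℚ
toℚ z = z ℚ./ 1

δ : ∀ {n} → Fin n → Fin n → ℚ
δ i j with i ≟ j
... | yes _ = 1ℚ
... | no  _ = 0ℚ

-- M is L_(q): M has zero row and zero column q, and the remaining block is
-- the inverse of the reduced Laplacian Q_q (Q with row/column q deleted),
-- i.e. for i, j ≠ q:  Σ_{k ≠ q} Q i k · M k j = δ i j.  (Since row q of M
-- is zero, the sum may equivalently range over all k.)
IsLq : ∀ {n} → Multigraph n → Fin n → (Fin n → Fin n → ℚ) → Set
IsLq {n} G q M =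
  (∀ j → M q j ≡ 0ℚ) ×' (∀ i → M i q ≡ 0ℚ) ×'
  (∀ i j → ¬ i ≡ q → ¬ j ≡ q →
     sumℚ (λ k → toℚ (laplacian G i k) ℚ.* M k j) ≡ δ i j)
  where
    open import Data.Product using () renaming (_×_ to _×'_)

reduce : ∀ {n} → Multigraph n → (Fin n → Fin n → ℚ) → Div n → Div n
reduce G L D v =
  D v ℤ.- sumℤ (λ k → laplacian G v k ℤ.*
                      floor (sumℚ (λ m → L k m ℚ.* toℚ (D m))))

-- Put x = L_(q)[D] and y = x − ⌊x⌋, so every y_k lies in [0,1). For v ≠ q the v-th row of
-- Q L_(q) is the unit row e_v, hence D(v) = (Q x)_v and
--   D′(v) = (Q x)_v − (Q ⌊x⌋)_v = (Q y)_v = Σ_k m(v,k) (y_v − y_k).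
-- Every y_v − y_k lies in (−1,1), and connectivity gives v a neighbour, so the sum lies
-- strictly between −Σ_k m(v,k) = −deg v and deg v.

module Submission where

open import Defs
open import Data.Nat as ℕ using (ℕ; zero; suc)
open import Data.Nat.Coprimality using (1-coprimeTo)
import Data.Nat.Coprimality as Coprime
open import Data.Integer as ℤ using (ℤ; -[1+_]; ∣_∣)
import Data.Integer.Properties as ℤP
import Data.Integer.DivMod as ℤD
open import Data.Rational as ℚ using (ℚ; mkℚ; floor; 0ℚ; 1ℚ; _+_; _*_; -_; _-_; _≤_; _<_)
import Data.Rational.Properties as ℚP
import Data.Rational.Unnormalised as ℚᵘ
import Data.Rational.Unnormalised.Properties as ℚᵘP
open import Data.Fin using (Fin; zero; suc; _≟_)
import Data.Fin.Properties as FinP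
open import Data.Vec.Functional using (Vector)
open import Data.Product using (∃; _,_; proj₁; proj₂)
open import Data.Empty using (⊥-elim)
open import Function using (_∘_)
open import Relation.Nullary using (¬_; yes; no)
open import Relation.Binary.PropositionalEquality
open import Algebra.Bundles using (Ring)
open import Algebra.Properties.Semiring.Sum (Ring.semiring ℚP.+-*-ring)
import Algebra.Properties.Ring ℚP.+-*-ring as ℚRing

toℚ-mkℚ : ∀ z → toℚ z ≡ mkℚ z 0 (Coprime.sym (1-coprimeTo ∣ z ∣))
toℚ-mkℚ z = ℚP.↥p/↧p≡p (mkℚ z 0 _)

toℚᵘ-toℚ : ∀ z → ℚ.toℚᵘ (toℚ z) ≡ ℚᵘ.mkℚᵘ z 0
toℚᵘ-toℚ z = cong ℚ.toℚᵘ (toℚ-mkℚ z)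

toℚ-+ : ∀ a b → toℚ (a ℤ.+ b) ≡ toℚ a + toℚ b
toℚ-+ a b = ℚP.toℚᵘ-injective (begin
  ℚ.toℚᵘ (toℚ (a ℤ.+ b))                 ≡⟨ toℚᵘ-toℚ (a ℤ.+ b) ⟩
  ℚᵘ.mkℚᵘ (a ℤ.+ b) 0                    ≈⟨ ℚᵘ.*≡* (cong₂ (λ x y → (x ℤ.+ y) ℤ.* ℤ.+ 1)
                                                (sym (ℤP.*-identityʳ a)) (sym (ℤP.*-identityʳ b))) ⟩
  ℚᵘ.mkℚᵘ a 0 ℚᵘ.+ ℚᵘ.mkℚᵘ b 0           ≡⟨ cong₂ ℚᵘ._+_ (toℚᵘ-toℚ a) (toℚᵘ-toℚ b) ⟨
  ℚ.toℚᵘ (toℚ a) ℚᵘ.+ ℚ.toℚᵘ (toℚ b)     ≈⟨ ℚP.toℚᵘ-homo-+ (toℚ a) (toℚ b) ⟨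
  ℚ.toℚᵘ (toℚ a + toℚ b)                 ∎)
  where open ℚᵘP.≃-Reasoning

toℚ-* : ∀ a b → toℚ (a ℤ.* b) ≡ toℚ a * toℚ b
toℚ-* a b = ℚP.toℚᵘ-injective (begin
  ℚ.toℚᵘ (toℚ (a ℤ.* b))                 ≡⟨ toℚᵘ-toℚ (a ℤ.* b) ⟩
  ℚᵘ.mkℚᵘ a 0 ℚᵘ.* ℚᵘ.mkℚᵘ b 0           ≡⟨ cong₂ ℚᵘ._*_ (toℚᵘ-toℚ a) (toℚᵘ-toℚ b) ⟨
  ℚ.toℚᵘ (toℚ a) ℚᵘ.* ℚ.toℚᵘ (toℚ b)     ≈⟨ ℚP.toℚᵘ-homo-* (toℚ a) (toℚ b) ⟨
  ℚ.toℚᵘ (toℚ a * toℚ b)                 ∎)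
  where open ℚᵘP.≃-Reasoning

toℚ-neg : ∀ a → toℚ (ℤ.- a) ≡ - toℚ a
toℚ-neg a = ℚP.toℚᵘ-injective (begin
  ℚ.toℚᵘ (toℚ (ℤ.- a))      ≡⟨ toℚᵘ-toℚ (ℤ.- a) ⟩
  ℚᵘ.- ℚᵘ.mkℚᵘ a 0          ≡⟨ cong ℚᵘ.-_ (toℚᵘ-toℚ a) ⟨
  ℚᵘ.- ℚ.toℚᵘ (toℚ a)       ≈⟨ ℚP.toℚᵘ-homo‿- (toℚ a) ⟨
  ℚ.toℚᵘ (- toℚ a)          ∎)
  where open ℚᵘP.≃-Reasoning

toℚ-cancel-< : ∀ {a b} → toℚ a < toℚ b → a ℤ.< b
toℚ-cancel-< {a} {b} a<b rewrite toℚ-mkℚ a | toℚ-mkℚ b with a<b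
... | ℚ.*<* p = subst₂ ℤ._<_ (ℤP.*-identityʳ a) (ℤP.*-identityʳ b) p

toℚ-floor-≤ : ∀ p → toℚ (floor p) ≤ p
toℚ-floor-≤ p@(mkℚ n d-1 _) rewrite toℚ-mkℚ (floor p) = ℚ.*≤* (begin
  floor p ℤ.* ℤ.+ d    ≡⟨ cong (ℤ._* ℤ.+ d) (ℤD.div-pos-is-/ℕ n d) ⟩
  n ℤD./ℕ d ℤ.* ℤ.+ d  ≤⟨ ℤD.[n/ℕd]*d≤n n d ⟩
  n                    ≡⟨ ℤP.*-identityʳ n ⟨
  n ℤ.* ℤ.+ 1          ∎)
  where
  open ℤP.≤-Reasoning
  d : ℕ
  d = suc d-1

<-toℚ-suc-floor : ∀ p → p < toℚ (ℤ.suc (floor p))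
<-toℚ-suc-floor p@(mkℚ n d-1 _) rewrite toℚ-mkℚ (ℤ.suc (floor p)) = ℚ.*<* (begin-strict
  n ℤ.* ℤ.+ 1                  ≡⟨ ℤP.*-identityʳ n ⟩
  n                            <⟨ ℤD.n<s[n/ℕd]*d n d ⟩
  ℤ.suc (n ℤD./ℕ d) ℤ.* ℤ.+ d  ≡⟨ cong (λ x → ℤ.suc x ℤ.* ℤ.+ d) (ℤD.div-pos-is-/ℕ n d) ⟨
  ℤ.suc (floor p) ℤ.* ℤ.+ d    ∎)
  where
  open ℤP.≤-Reasoning
  d : ℕ
  d = suc d-1

-n<i<n⇒∣i∣<n : ∀ {n} i → ℤ.- ℤ.+ n ℤ.< i → i ℤ.< ℤ.+ n → ∣ i ∣ ℕ.< n
-n<i<n⇒∣i∣<n          (ℤ.+ _)   _             (ℤ.+<+ m<n) = m<n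
-n<i<n⇒∣i∣<n {suc _}  -[1+ _ ]  (ℤ.-<- m<n)  _           = ℕ.s<s m<n

sumℚ≡sum : ∀ {n} (f : Vector ℚ n) → sumℚ f ≡ sum f
sumℚ≡sum {zero}  f = refl
sumℚ≡sum {suc n} f = cong (f zero +_) (sumℚ≡sum (f ∘ suc))

sum-neg : ∀ {n} (f : Vector ℚ n) → sum (λ k → - f k) ≡ - sum f
sum-neg f = begin
  sum (λ k → - f k)         ≡⟨ sum-cong-≗ (λ k → ℚRing.-1*x≈-x (f k)) ⟨
  sum (λ k → - 1ℚ * f k)    ≡⟨ *-distribˡ-sum (- 1ℚ) f ⟨
  - 1ℚ * sum f              ≡⟨ ℚRing.-1*x≈-x (sum f) ⟩
  - sum f                   ∎
  where open ≡-Reasoning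

∑-distrib-- : ∀ {n} (f g : Vector ℚ n) → sum (λ k → f k - g k) ≡ sum f - sum g
∑-distrib-- f g = trans (∑-distrib-+ f (λ k → - g k)) (cong (sum f +_) (sum-neg g))

sum-pointwise : ∀ {n} (f : Vector ℚ n) v → (∀ k → ¬ k ≡ v → f k ≡ 0ℚ) → sum f ≡ f v
sum-pointwise {suc n} f zero vanish = begin
  f zero + sum (f ∘ suc)       ≡⟨ cong (f zero +_) (sum-cong-≗ (λ k → vanish (suc k) λ ())) ⟩
  f zero + sum {n} (λ _ → 0ℚ)  ≡⟨ cong (f zero +_) (sum-replicate-zero n) ⟩
  f zero + 0ℚ                  ≡⟨ ℚP.+-identityʳ (f zero) ⟩
  f zero                       ∎
  where open ≡-Reasoning
sum-pointwise {suc n} f (suc v) vanish = begin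
  f zero + sum (f ∘ suc)  ≡⟨ cong (_+ sum (f ∘ suc)) (vanish zero λ ()) ⟩
  0ℚ + sum (f ∘ suc)      ≡⟨ ℚP.+-identityˡ (sum (f ∘ suc)) ⟩
  sum (f ∘ suc)           ≡⟨ sum-pointwise (f ∘ suc) v (λ k k≢v → vanish (suc k) (k≢v ∘ FinP.suc-injective)) ⟩
  f (suc v)               ∎
  where open ≡-Reasoning

sum-mono-≤ : ∀ {n} {f g : Vector ℚ n} → (∀ k → f k ≤ g k) → sum f ≤ sum g
sum-mono-≤ {zero}  f≤g = ℚP.≤-refl
sum-mono-≤ {suc n} f≤g = ℚP.+-mono-≤ (f≤g zero) (sum-mono-≤ (f≤g ∘ suc))

sum-mono-< : ∀ {n} {f g : Vector ℚ n} → (∀ k → f k ≤ g k) → ∀ j → f j < g j → sum f < sum g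
sum-mono-< f≤g zero    fj<gj = ℚP.+-mono-<-≤ fj<gj (sum-mono-≤ (f≤g ∘ suc))
sum-mono-< f≤g (suc j) fj<gj = ℚP.+-mono-≤-< (f≤g zero) (sum-mono-< (f≤g ∘ suc) j fj<gj)

toℚ-sumℤ : ∀ {n} (f : Fin n → ℤ) → toℚ (sumℤ f) ≡ sum (toℚ ∘ f)
toℚ-sumℤ {zero}  f = refl
toℚ-sumℤ {suc n} f = trans (toℚ-+ (f zero) _) (cong (toℚ (f zero) +_) (toℚ-sumℤ (f ∘ suc)))

toℚ-sumℕ : ∀ {n} (f : Fin n → ℕ) → toℚ (ℤ.+ sumℕ f) ≡ sum (λ k → toℚ (ℤ.+ f k))
toℚ-sumℕ {zero}  f = refl
toℚ-sumℕ {suc n} f = trans (toℚ-+ (ℤ.+ f zero) (ℤ.+ sumℕ (f ∘ suc)))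
                            (cong (toℚ (ℤ.+ f zero) +_) (toℚ-sumℕ (f ∘ suc)))

fract : ℚ → ℚ
fract p = p - toℚ (floor p)

fract-nonNeg : ∀ p → 0ℚ ≤ fract p
fract-nonNeg p = subst (_≤ fract p) (ℚP.+-inverseʳ (toℚ (floor p)))
  (ℚP.+-monoˡ-≤ (- toℚ (floor p)) (toℚ-floor-≤ p))

fract<1 : ∀ p → fract p < 1ℚ
fract<1 p = subst (fract p <_) (ℚRing.//-rightDividesʳ t 1ℚ) (ℚP.+-monoˡ-< (- t) p<1+t)
  where
  t : ℚ
  t = toℚ (floor p)
  p<1+t : p < 1ℚ + t
  p<1+t = subst (p <_) (toℚ-+ ℤ.1ℤ (floor p)) (<-toℚ-suc-floor p)

fract-sub-< : ∀ p p′ → fract p - fract p′ < 1ℚ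
fract-sub-< p p′ = ℚP.≤-<-trans (begin
  fract p - fract p′  ≤⟨ ℚP.+-monoʳ-≤ (fract p) (ℚP.neg-antimono-≤ (fract-nonNeg p′)) ⟩
  fract p + 0ℚ        ≡⟨ ℚP.+-identityʳ (fract p) ⟩
  fract p             ∎) (fract<1 p)
  where open ℚP.≤-Reasoning

fract-sub-> : ∀ p p′ → - 1ℚ < fract p - fract p′
fract-sub-> p p′ = ℚP.<-≤-trans (ℚP.neg-antimono-< (fract<1 p′)) (begin
  - fract p′            ≡⟨ ℚP.+-identityˡ (- fract p′) ⟨
  0ℚ - fract p′         ≤⟨ ℚP.+-monoˡ-≤ (- fract p′) (fract-nonNeg p) ⟩
  fract p - fract p′    ∎)
  where open ℚP.≤-Reasoning

toℚ-nonNeg : ∀ m → ℚ.NonNegative (toℚ (ℤ.+ m))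
toℚ-nonNeg m = ℚP.normalize-nonNeg m 1

toℚ-pos : ∀ {m} → 0 ℕ.< m → ℚ.Positive (toℚ (ℤ.+ m))
toℚ-pos {suc m} _ = ℚP.normalize-pos (suc m) 1

weighted-sum-< : ∀ {n} (w : Fin n → ℕ) (s : Vector ℚ n) → (∀ k → s k < 1ℚ) →
  (∃ λ j → 0 ℕ.< w j) → sum (λ k → toℚ (ℤ.+ w k) * s k) < toℚ (ℤ.+ sumℕ w)
weighted-sum-< w s s<1 (j , 0<wj) =
  subst (sum (λ k → W k * s k) <_) (sym (toℚ-sumℕ w)) (sum-mono-< term-≤ j term-<)
  where
  W : Fin _ → ℚ
  W k = toℚ (ℤ.+ w k)
  term-≤ : ∀ k → W k * s k ≤ W k
  term-≤ k = subst (W k * s k ≤_) (ℚP.*-identityʳ (W k))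
    (ℚP.*-monoˡ-≤-nonNeg (W k) {{toℚ-nonNeg (w k)}} (ℚP.<⇒≤ (s<1 k)))
  term-< : W j * s j < W j
  term-< = subst (W j * s j <_) (ℚP.*-identityʳ (W j))
    (ℚP.*-monoʳ-<-pos (W j) {{toℚ-pos 0<wj}} (s<1 j))

weighted-sum-> : ∀ {n} (w : Fin n → ℕ) (s : Vector ℚ n) → (∀ k → - 1ℚ < s k) →
  (∃ λ j → 0 ℕ.< w j) → - toℚ (ℤ.+ sumℕ w) < sum (λ k → toℚ (ℤ.+ w k) * s k)
weighted-sum-> w s -1<s w>0 = subst (- toℚ (ℤ.+ sumℕ w) <_) (ℚRing.-‿involutive Σws)
  (ℚP.neg-antimono-< (subst (_< toℚ (ℤ.+ sumℕ w)) Σw[-s]≡-Σws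
    (weighted-sum-< w (-_ ∘ s) (ℚP.neg-antimono-< ∘ -1<s) w>0)))
  where
  Σws : ℚ
  Σws = sum (λ k → toℚ (ℤ.+ w k) * s k)
  Σw[-s]≡-Σws : sum (λ k → toℚ (ℤ.+ w k) * - s k) ≡ - Σws
  Σw[-s]≡-Σws = trans (sum-cong-≗ (λ k → sym (ℚP.neg-distribʳ-* (toℚ (ℤ.+ w k)) (s k))))
                      (sum-neg (λ k → toℚ (ℤ.+ w k) * s k))

δ-diag : ∀ {n} (v : Fin n) → δ v v ≡ 1ℚ
δ-diag v with v ≟ v
... | yes _  = refl
... | no v≢v = ⊥-elim (v≢v refl)

δ-offDiag : ∀ {n} {v m : Fin n} → ¬ v ≡ m → δ v m ≡ 0ℚ
δ-offDiag {v = v} {m} v≢m with v ≟ m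
... | yes v≡m = ⊥-elim (v≢m v≡m)
... | no _    = refl

module _ {n} (G : Multigraph n) where
  open Multigraph G

  laplacian-diag : ∀ v → laplacian G v v ≡ ℤ.+ deg G v
  laplacian-diag v with v ≟ v
  ... | yes _  = refl
  ... | no v≢v = ⊥-elim (v≢v refl)

  laplacian-offDiag : ∀ {v k} → ¬ v ≡ k → laplacian G v k ≡ ℤ.- ℤ.+ mult v k
  laplacian-offDiag {v} {k} v≢k with v ≟ k
  ... | yes v≡k = ⊥-elim (v≢k v≡k)
  ... | no _    = refl

  ∃-neighbour : ∀ {v q} → Reachable G v q → ¬ v ≡ q → ∃ λ j → 0 ℕ.< mult v j
  ∃-neighbour here         v≢q = ⊥-elim (v≢q refl)
  ∃-neighbour (step 0<m _) _   = _ , 0<m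

  laplacian-row : Loopless G → ∀ v (y : Vector ℚ n) →
    sum (λ k → toℚ (laplacian G v k) * y k) ≡ sum (λ k → toℚ (ℤ.+ mult v k) * (y v - y k))
  laplacian-row loopless v y = begin
    sum (λ k → Q k * y k)                          ≡⟨ ℚRing.x≈z//y _ (sum (λ k → m k * y k)) _ Σ[Q+m]y ⟩
    d * y v - sum (λ k → m k * y k)                ≡⟨ cong (_- sum (λ k → m k * y k)) Σm≡d ⟨
    sum (λ k → m k * y v) - sum (λ k → m k * y k)  ≡⟨ ∑-distrib-- (λ k → m k * y v) (λ k → m k * y k) ⟨
    sum (λ k → m k * y v - m k * y k)              ≡⟨ sum-cong-≗ (λ k → ℚRing.x[y-z]≈xy-xz (m k) (y v) (y k)) ⟨
    sum (λ k → m k * (y v - y k))                  ∎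
    where
    open ≡-Reasoning
    Q m : Vector ℚ n
    Q k = toℚ (laplacian G v k)
    m k = toℚ (ℤ.+ mult v k)
    d : ℚ
    d = toℚ (ℤ.+ deg G v)
    Σm≡d : sum (λ k → m k * y v) ≡ d * y v
    Σm≡d = trans (sym (*-distribʳ-sum (y v) m)) (cong (_* y v) (sym (toℚ-sumℕ (mult v))))
    cancels-off-v : ∀ k → ¬ k ≡ v → Q k * y k + m k * y k ≡ 0ℚ
    cancels-off-v k k≢v = begin
      Q k * y k + m k * y k                     ≡⟨ cong (λ z → toℚ z * y k + m k * y k)
                                                      (laplacian-offDiag (k≢v ∘ sym)) ⟩
      toℚ (ℤ.- ℤ.+ mult v k) * y k + m k * y k  ≡⟨ cong (λ z → z * y k + m k * y k) (toℚ-neg (ℤ.+ mult v k)) ⟩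
      - m k * y k + m k * y k                   ≡⟨ cong (_+ m k * y k) (ℚP.neg-distribˡ-* (m k) (y k)) ⟨
      - (m k * y k) + m k * y k                 ≡⟨ ℚP.+-inverseˡ (m k * y k) ⟩
      0ℚ                                        ∎
    Σ[Q+m]y : sum (λ k → Q k * y k) + sum (λ k → m k * y k) ≡ d * y v
    Σ[Q+m]y = begin
      sum (λ k → Q k * y k) + sum (λ k → m k * y k)  ≡⟨ ∑-distrib-+ (λ k → Q k * y k) (λ k → m k * y k) ⟨
      sum (λ k → Q k * y k + m k * y k)              ≡⟨ sum-pointwise _ v cancels-off-v ⟩
      Q v * y v + m v * y v                          ≡⟨ cong₂ (λ a b → toℚ a * y v + toℚ (ℤ.+ b) * y v)
                                                          (laplacian-diag v) (loopless v) ⟩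
      d * y v + 0ℚ * y v                             ≡⟨ cong (d * y v +_) (ℚP.*-zeroˡ (y v)) ⟩
      d * y v + 0ℚ                                   ≡⟨ ℚP.+-identityʳ (d * y v) ⟩
      d * y v                                        ∎

  module _ {q} {L : Fin n → Fin n → ℚ} (isLq : IsLq G q L) {v} (v≢q : ¬ v ≡ q) where

    column-q-zero : ∀ k → L k q ≡ 0ℚ
    column-q-zero = proj₁ (proj₂ isLq)

    reduced-inverse : ∀ i j → ¬ i ≡ q → ¬ j ≡ q →
      sumℚ (λ k → toℚ (laplacian G i k) * L k j) ≡ δ i j
    reduced-inverse = proj₂ (proj₂ isLq)

    Lq-row : ∀ m → sum (λ k → toℚ (laplacian G v k) * L k m) ≡ δ v m
    Lq-row m with m ≟ q
    ... | yes refl = begin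
      sum (λ k → toℚ (laplacian G v k) * L k m)  ≡⟨ sum-cong-≗ (λ k → cong (toℚ (laplacian G v k) *_) (column-q-zero k)) ⟩
      sum (λ k → toℚ (laplacian G v k) * 0ℚ)     ≡⟨ sum-cong-≗ (λ k → ℚP.*-zeroʳ (toℚ (laplacian G v k))) ⟩
      sum {n} (λ _ → 0ℚ)                         ≡⟨ sum-replicate-zero n ⟩
      0ℚ                                         ≡⟨ δ-offDiag v≢q ⟨
      δ v m                                      ∎
      where open ≡-Reasoning
    ... | no m≢q = trans (sym (sumℚ≡sum (λ k → toℚ (laplacian G v k) * L k m)))
                         (reduced-inverse v m v≢q m≢q)

    Lq-rightInverse : ∀ (y : Vector ℚ n) →
      sum (λ k → toℚ (laplacian G v k) * sumℚ (λ m → L k m * y m)) ≡ y v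
    Lq-rightInverse y = begin
      sum (λ k → Q k * sumℚ (λ m → L k m * y m))   ≡⟨ sum-cong-≗ (λ k → cong (Q k *_) (sumℚ≡sum (λ m → L k m * y m))) ⟩
      sum (λ k → Q k * sum (λ m → L k m * y m))    ≡⟨ sum-cong-≗ (λ k → *-distribˡ-sum (Q k) (λ m → L k m * y m)) ⟩
      sum (λ k → sum (λ m → Q k * (L k m * y m)))  ≡⟨ ∑-comm (λ k m → Q k * (L k m * y m)) ⟩
      sum (λ m → sum (λ k → Q k * (L k m * y m)))  ≡⟨ sum-cong-≗ (λ m → sum-cong-≗ (λ k → ℚP.*-assoc (Q k) (L k m) (y m))) ⟨
      sum (λ m → sum (λ k → Q k * L k m * y m))    ≡⟨ sum-cong-≗ (λ m → *-distribʳ-sum (y m) (λ k → Q k * L k m)) ⟨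
      sum (λ m → sum (λ k → Q k * L k m) * y m)    ≡⟨ sum-cong-≗ (λ m → cong (_* y m) (Lq-row m)) ⟩
      sum (λ m → δ v m * y m)                      ≡⟨ sum-pointwise (λ m → δ v m * y m) v δ-vanishes ⟩
      δ v v * y v                                  ≡⟨ cong (_* y v) (δ-diag v) ⟩
      1ℚ * y v                                     ≡⟨ ℚP.*-identityˡ (y v) ⟩
      y v                                          ∎
      where
      open ≡-Reasoning
      Q : Vector ℚ n
      Q k = toℚ (laplacian G v k)
      δ-vanishes : ∀ m → ¬ m ≡ v → δ v m * y m ≡ 0ℚ
      δ-vanishes m m≢v = trans (cong (_* y m) (δ-offDiag (m≢v ∘ sym))) (ℚP.*-zeroˡ (y m))

    toℚ-reduce : ∀ D → toℚ (reduce G L D v) ≡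
      sum (λ k → toℚ (laplacian G v k) * fract (sumℚ (λ m → L k m * toℚ (D m))))
    toℚ-reduce D = begin
      toℚ (D v ℤ.- S)                                 ≡⟨ toℚ-+ (D v) (ℤ.- S) ⟩
      toℚ (D v) + toℚ (ℤ.- S)                         ≡⟨ cong (toℚ (D v) +_) (toℚ-neg S) ⟩
      toℚ (D v) - toℚ S                               ≡⟨ cong₂ _-_ (sym (Lq-rightInverse (toℚ ∘ D))) toℚ-S ⟩
      sum (λ k → Q k * x k) - sum (λ k → Q k * t k)   ≡⟨ ∑-distrib-- (λ k → Q k * x k) (λ k → Q k * t k) ⟨
      sum (λ k → Q k * x k - Q k * t k)               ≡⟨ sum-cong-≗ (λ k → ℚRing.x[y-z]≈xy-xz (Q k) (x k) (t k)) ⟨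
      sum (λ k → Q k * fract (x k))                   ∎
      where
      open ≡-Reasoning
      Q x t : Vector ℚ n
      Q k = toℚ (laplacian G v k)
      x k = sumℚ (λ m → L k m * toℚ (D m))
      t k = toℚ (floor (x k))
      S : ℤ
      S = sumℤ (λ k → laplacian G v k ℤ.* floor (x k))
      toℚ-S : toℚ S ≡ sum (λ k → Q k * t k)
      toℚ-S = trans (toℚ-sumℤ (λ k → laplacian G v k ℤ.* floor (x k)))
                    (sum-cong-≗ (λ k → toℚ-* (laplacian G v k) (floor (x k))))

proposition5p4 : ∀ {n} (G : Multigraph n) → Loopless G → Connected G →
    (q : Fin n) (L : Fin n → Fin n → ℚ) → IsLq G q L →
    (D : Div n) → ∀ v → ¬ v ≡ q → ∣ reduce G L D v ∣ ℕ.< deg G v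
proposition5p4 G loopless connected q L isLq D v v≢q =
  -n<i<n⇒∣i∣<n (reduce G L D v) (toℚ-cancel-< lower) (toℚ-cancel-< upper)
  where
  open Multigraph G
  x : Vector ℚ _
  x k = sumℚ (λ m → L k m * toℚ (D m))
  s : Vector ℚ _
  s k = fract (x v) - fract (x k)
  D′≡ : toℚ (reduce G L D v) ≡ sum (λ k → toℚ (ℤ.+ mult v k) * s k)
  D′≡ = trans (toℚ-reduce G isLq v≢q D) (laplacian-row G loopless v (fract ∘ x))
  neighbour : ∃ λ j → 0 ℕ.< mult v j
  neighbour = ∃-neighbour G (connected v q) v≢q
  upper : toℚ (reduce G L D v) < toℚ (ℤ.+ deg G v)
  upper = subst (_< toℚ (ℤ.+ deg G v)) (sym D′≡)
    (weighted-sum-< (mult v) s (λ k → fract-sub-< (x v) (x k)) neighbour)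
  lower : toℚ (ℤ.- ℤ.+ deg G v) < toℚ (reduce G L D v)
  lower = subst₂ _<_ (sym (toℚ-neg (ℤ.+ deg G v))) (sym D′≡)
    (weighted-sum-> (mult v) s (λ k → fract-sub-> (x v) (x k)) neighbour)
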